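{- Let $H$ be an outerplane graph with $t$ inner triangles. Then there exists a triangular cactus in $H$ with $\lceil t/2\rceil$ triangles.
   Context: All graphs are finite and simple. An outerplane graph is a planar graph with a fixed crossing-free embedding in the plane such that every vertex lies on the boundary of the unbounded (outer) face; the other faces are inner faces. A triangle is a cycle of length $3$; an inner triangle of $H$ is a triangle that is the boundary of an inner face of $H$. A triangular cactus is a graph all of whose cycles (if any) are triangles and in which every edge lies on some cycle; a triangular cactus in $H$ is a subgraph of $H$ that is a triangular cactus, and its number of triangles is its number of cycles. -}

module Defs where

open import Data.Nat using (ℕ; _<ᵇ_; _≤_; ⌈_/2⌉)
open import Data.Fin using (Fin; toℕ; _<_)
open import Data.Bool using (Bool; true; false; _∧_)
open import Data.List using (List; []; _∷_; length; allFin; concatMap; filterᵇ; map)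
open import Data.List.Relation.Unary.Unique.Propositional using (Unique)
open import Data.Product using (_×_; _,_; Σ; ∃)
open import Data.Empty using (⊥)
open import Relation.Binary.PropositionalEquality using (_≡_)

Adj : ℕ → Set
Adj n = Fin n → Fin n → Bool

record IsSimpleGraph {n : ℕ} (G : Adj n) : Set where
  field
    symm   : ∀ a b → G a b ≡ G b a
    irrefl : ∀ a → G a a ≡ false

-- Outerplane graph (combinatorial encoding of a fixed outerplane embedding):
-- the vertices 0,1,…,n-1 lie on the boundary of the outer face in this
-- cyclic order, and edges are drawn as non-crossing chords, i.e. there are
-- no a < b < c < d with ac and bd both edges.
record IsOuterplane {n : ℕ} (G : Adj n) : Set where
  field
    simple      : IsSimpleGraph G
    noncrossing : ∀ a b c d → a < b → b < c → c < d →
                  G a c ≡ true → G b d ≡ true → ⊥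

triples : (n : ℕ) → List (Fin n × Fin n × Fin n)
triples n = concatMap (λ a → concatMap (λ b → map (λ c → a , b , c) (allFin n)) (allFin n)) (allFin n)

isTriangle : {n : ℕ} → Adj n → Fin n × Fin n × Fin n → Bool
isTriangle G (a , b , c) =
  (toℕ a <ᵇ toℕ b) ∧ (toℕ b <ᵇ toℕ c) ∧ G a b ∧ G b c ∧ G a c

triangleCount : {n : ℕ} → Adj n → ℕ
triangleCount {n} G = length (filterᵇ (isTriangle G) (triples n))

-- In an outerplane graph
-- every triangle bounds an inner face (its interior contains no vertex, hence
-- no edge), so inner triangles are exactly the triangles.
innerTriangleCount : {n : ℕ} → Adj n → ℕ
innerTriangleCount = triangleCount

-- Subgraph (edge set; vertices are all of Fin n, isolated vertices being harmless).
_⊆G_ : {n : ℕ} → Adj n → Adj n → Set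
S ⊆G G = ∀ a b → S a b ≡ true → G a b ≡ true

data IsWalk {n : ℕ} (S : Adj n) : List (Fin n) → Set where
  single : ∀ v → IsWalk S (v ∷ [])
  step   : ∀ u v vs → S u v ≡ true → IsWalk S (v ∷ vs) → IsWalk S (u ∷ v ∷ vs)

last : {A : Set} → A → List A → A
last x []       = x
last x (y ∷ ys) = last y ys

IsCycle : {n : ℕ} → Adj n → List (Fin n) → Set
IsCycle S []       = ⊥
IsCycle S (v ∷ vs) =
  (3 ≤ length (v ∷ vs)) × Unique (v ∷ vs) × IsWalk S (v ∷ vs) × (S (last v vs) v ≡ true)

-- The edge uv lies on some cycle of S (a cycle through uv, rotated/reflected
-- so that it starts u, v).
EdgeOnCycle : {n : ℕ} → Adj n → Fin n → Fin n → Set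
EdgeOnCycle S u v = Σ (List _) λ rest → IsCycle S (u ∷ v ∷ rest)

record IsTriangularCactus {n : ℕ} (S : Adj n) : Set where
  field
    simple         : IsSimpleGraph S
    cyclesTriangle : ∀ cs → IsCycle S cs → length cs ≡ 3
    edgesOnCycle   : ∀ u v → S u v ≡ true → EdgeOnCycle S u v

cactusTriangleCount : {n : ℕ} → Adj n → ℕ
cactusTriangleCount = triangleCount

{-# OPTIONS --safe #-}
module Submission where

-- Number the vertices 0, …, n-1 along the outer face, so that edges are non-crossing chords.
-- For an interval [u, w] containing c triangles, induction on w - u produces three triangular
-- cacti made of triangles inside [u, w]: ⌈c/2⌉ triangles attachable to other cacti at u,
-- ⌈c/2⌉ attachable at w, and ⌊c/2⌋ attachable at u and w at once.  Let v be the largest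
-- neighbour of u below w.  As chords do not cross, a triangle inside [u, w] lies inside [u, v],
-- inside [v, w], or is uvw.  The cacti of the two halves meet only in v and glue along it, and
-- when uvw is a triangle it can instead join the two halves' cacti attachable at both ends; a
-- parity count shows that one of these combinations always has enough triangles.  For [0, n-1],
-- after dropping surplus triangles, this is the required cactus.

open import Defs
open import Level using (0ℓ)
open import Data.Bool using (Bool; true; false; T)
open import Data.Bool.Properties using (T-≡; T-∧)
open import Data.Empty using (⊥; ⊥-elim)
open import Data.Fin using (Fin; toℕ; fromℕ<)
open import Data.Fin.Properties using (toℕ-injective; toℕ-fromℕ<; fromℕ<-toℕ; toℕ<n)
open import Data.List using (List; []; _∷_; [_]; length; _++_; drop; map; filter; allFin; concatMap; cartesianProduct; cartesianProductWith)
open import Data.List.Properties using (∷ʳ-++; filter-≐; filter-accept; filter-reject; filter-none; map-concatMap; concatMap-cong; map-∘; length-++; length-++-comm; length-drop; length-map; ++-assoc; ++-identityʳ)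
open import Data.List.Membership.Propositional using (_∈_; find; lose)
open import Data.List.Membership.Propositional.Properties using (∈-cartesianProduct⁺; ∈-allFin; ∈-∃++; ∈-++⁻; ∈-++⁺ˡ; ∈-++⁺ʳ)
open import Data.List.Relation.Unary.All as All using (All; []; _∷_)
import Data.List.Relation.Unary.All.Properties as All
open import Data.List.Relation.Unary.Any as Any using (Any; here; there; any?)
open import Data.List.Relation.Unary.Any.Properties using (++⁻)
open import Data.List.Relation.Unary.AllPairs using ([]; _∷_)
open import Data.List.Relation.Unary.Unique.Propositional using (Unique)
import Data.List.Relation.Unary.Unique.Propositional.Properties as Unique
open import Data.Nat using (ℕ; zero; suc; _+_; _∸_; _≤_; _<_; _<ᵇ_; z≤n; s≤s; ⌈_/2⌉; ⌊_/2⌋)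
open import Data.Nat.Properties
open import Data.List.Membership.DecPropositional _≟_ using (_∈?_)
open import Data.Product using (Σ; ∃-syntax; _×_; _,_; proj₁; proj₂)
open import Data.Product.Properties using (≡-dec)
open import Data.Product.Function.NonDependent.Propositional using (_×-⇔_)
import Data.Sum as Sum
open import Data.Sum using (_⊎_; inj₁; inj₂; [_,_]′; map₁; map₂; swap; assocʳ; assocˡ)
open import Function using (_∘_; _⇔_; mk⇔; Equivalence)
open import Function.Properties.Equivalence using () renaming (trans to ⇔-trans)
open import Relation.Binary using (Rel; Symmetric; Decidable; DecidableEquality; tri<; tri≈; tri>)
open import Relation.Binary.PropositionalEquality hiding ([_])
open import Relation.Nullary using (¬_; Dec; yes; no; _×-dec_; _⊎-dec_; ¬?; contradiction)
open import Relation.Nullary.Decidable using (T?; ⌊_⌋; toWitness; fromWitness; isYes≗does; does-⇔; dec-false)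
open import Relation.Unary using (Pred; _≐_) renaming (Decidable to Decidable₁)
open import Relation.Unary.Properties using (_∪?_)

count : {A : Set} {P : Pred A 0ℓ} → Decidable₁ P → List A → ℕ
count P? xs = length (filter P? xs)

module _ {A : Set} {P : Pred A 0ℓ} (P? : Decidable₁ P) where

  count-≐ : ∀ {Q} (Q? : Decidable₁ Q) → P ≐ Q → ∀ xs → count P? xs ≡ count Q? xs
  count-≐ Q? P≐Q xs = cong length (filter-≐ P? Q? P≐Q xs)

  count-∅ : (∀ x → ¬ P x) → ∀ xs → count P? xs ≡ 0
  count-∅ ¬P xs = cong length (filter-none P? (All.universal ¬P xs))

  count-∪ : ∀ {Q} (Q? : Decidable₁ Q) → (∀ {x} → P x → Q x → ⊥) →
    ∀ xs → count (P? ∪? Q?) xs ≡ count P? xs + count Q? xs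
  count-∪ Q? disjoint [] = refl
  count-∪ Q? disjoint (x ∷ xs) with P? x | Q? x
  ... | yes px | yes qx = ⊥-elim (disjoint px qx)
  ... | yes _  | no _   = cong suc (count-∪ Q? disjoint xs)
  ... | no _   | yes _  = trans (cong suc (count-∪ Q? disjoint xs)) (sym (+-suc _ _))
  ... | no _   | no _   = count-∪ Q? disjoint xs

  count-unique : ∀ {x xs} → Unique xs → x ∈ xs → P x → (∀ {y} → P y → y ≡ x) → count P? xs ≡ 1
  count-unique {xs = y ∷ ys} (y∉ys ∷ _) (here refl) px only =
    cong length (trans (filter-accept P? px) (cong (y ∷_) (filter-none P? (All.map (λ y≢z pz → y≢z (sym (only pz))) y∉ys))))
  count-unique {xs = y ∷ ys} (y∉ys ∷ !ys) (there x∈ys) px only =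
    trans (cong length (filter-reject P? (λ py → All.lookup y∉ys x∈ys (only py)))) (count-unique !ys x∈ys px only)

-- Walks and cycles

-- IsWalk and IsCycle of Defs, for relations on an arbitrary vertex type.
module _ {V : Set} (R : Rel V 0ℓ) where

  data Walk : List V → Set where
    end : ∀ v → Walk [ v ]
    _∷_ : ∀ {u v vs} → R u v → Walk (v ∷ vs) → Walk (u ∷ v ∷ vs)

  Cycle : List V → Set
  Cycle []       = ⊥
  Cycle (v ∷ vs) = 3 ≤ length (v ∷ vs) × Unique (v ∷ vs) × Walk (v ∷ vs) × R (last v vs) v

  last-∷ʳ : ∀ (y : V) ys x → last y (ys ++ [ x ]) ≡ x
  last-∷ʳ y []       x = refl
  last-∷ʳ y (z ∷ zs) x = last-∷ʳ z zs x

  Walk-∷ʳ : ∀ {y ys x} → Walk (y ∷ ys) → R (last y ys) x → Walk (y ∷ ys ++ [ x ])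
  Walk-∷ʳ (end _)  e = e ∷ end _
  Walk-∷ʳ (e′ ∷ w) e = e′ ∷ Walk-∷ʳ w e

  Cycle-rotate₁ : ∀ x xs → Cycle (x ∷ xs) → Cycle (xs ++ [ x ])
  Cycle-rotate₁ x []       (s≤s () , _)
  Cycle-rotate₁ x (y ∷ ys) (len , (x∉ ∷ !yys) , (xy ∷ w) , closing) =
    subst (3 ≤_) (length-++-comm [ x ] (y ∷ ys)) len ,
    Unique.++⁺ !yys ([] ∷ []) (λ { (z∈yys , here refl) → All.lookup x∉ z∈yys refl }) ,
    Walk-∷ʳ w closing ,
    subst (λ z → R z y) (sym (last-∷ʳ y ys x)) xy

  Cycle-rotate : ∀ xs ys → Cycle (xs ++ ys) → Cycle (ys ++ xs)
  Cycle-rotate []       ys c = subst Cycle (sym (++-identityʳ ys)) c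
  Cycle-rotate (x ∷ xs) ys c = subst Cycle (∷ʳ-++ ys x xs)
    (Cycle-rotate xs (ys ++ [ x ]) (subst Cycle (++-assoc xs ys [ x ]) (Cycle-rotate₁ x (xs ++ ys) c)))

  Walk-confined : Symmetric R → (K : Pred V 0ℓ) {r : V} → (∀ {x y} → K x → R x y → y ≢ r → K y) →
    ∀ {vs} → All (_≢ r) vs → Walk vs → Any K vs → All K vs
  Walk-confined R-sym K closed (_ ∷ [])            (end _)  (here k)  = k ∷ []
  Walk-confined R-sym K closed (_ ∷ v≢r ∷ ≢r)     (uv ∷ w) (here ku) =
    ku ∷ Walk-confined R-sym K closed (v≢r ∷ ≢r) w (here (closed ku uv v≢r))
  Walk-confined R-sym K closed (u≢r ∷ ≢r@(_ ∷ _)) (uv ∷ w) (there k) with Walk-confined R-sym K closed ≢r w k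
  ... | kv ∷ ks = closed kv (R-sym uv) u≢r ∷ kv ∷ ks

  Unique⇒length≤2 : ∀ {p q : V} {xs} → Unique xs → All (λ z → z ≡ p ⊎ z ≡ q) xs → length xs ≤ 2
  Unique⇒length≤2 {xs = []}                 _ _ = z≤n
  Unique⇒length≤2 {xs = _ ∷ []}             _ _ = s≤s z≤n
  Unique⇒length≤2 {xs = _ ∷ _ ∷ []}         _ _ = s≤s (s≤s z≤n)
  Unique⇒length≤2 {xs = _ ∷ _ ∷ _ ∷ _} ((a≢b ∷ a≢c ∷ _) ∷ (b≢c ∷ _) ∷ _) (a ∷ b ∷ c ∷ _) =
    ⊥-elim (pigeonhole a b c)
    where
    pigeonhole : _ → _ → _ → ⊥
    pigeonhole (inj₁ refl) (inj₁ refl) _           = a≢b refl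
    pigeonhole (inj₂ refl) (inj₂ refl) _           = a≢b refl
    pigeonhole (inj₁ refl) (inj₂ refl) (inj₁ refl) = a≢c refl
    pigeonhole (inj₁ refl) (inj₂ refl) (inj₂ refl) = b≢c refl
    pigeonhole (inj₂ refl) (inj₁ refl) (inj₁ refl) = b≢c refl
    pigeonhole (inj₂ refl) (inj₁ refl) (inj₂ refl) = a≢c refl

  -- Along the cycle, {p, q} can only be left through r; so after rotating the cycle to start at r,
  -- all its other vertices lie in {p, q}.
  cycle-through-pendant : DecidableEquality V → Symmetric R → ∀ {p q r C} → p ≢ r →
    (∀ {y} → R p y → y ≡ q ⊎ y ≡ r) → (∀ {y} → R q y → y ≡ p ⊎ y ≡ r) → Cycle C → p ∈ C → length C ≡ 3
  cycle-through-pendant _≟_ R-sym {p} {q} {r} {C = v ∷ vs} p≢r Np Nq c@(3≤ , !C , walk , _) p∈C = ≤-antisym bound 3≤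
    where
    K : Pred V 0ℓ
    K z = z ≡ p ⊎ z ≡ q

    closed : ∀ {x y} → K x → R x y → y ≢ r → K y
    closed (inj₁ refl) e y≢r = inj₂ ([ (λ y≡q → y≡q) , (λ y≡r → contradiction y≡r y≢r) ]′ (Np e))
    closed (inj₂ refl) e y≢r = inj₁ ([ (λ y≡p → y≡p) , (λ y≡r → contradiction y≡r y≢r) ]′ (Nq e))

    tail-confined : ∀ {x xs} → Walk (x ∷ xs) → All (_≢ r) xs → p ∈ xs → All K xs
    tail-confined (_ ∷ w) ≢r p∈xs = Walk-confined R-sym K closed ≢r w (Any.map (inj₁ ∘ sym) p∈xs)

    bound : length (v ∷ vs) ≤ 3
    bound with any? (r ≟_) (v ∷ vs)
    ... | no r∉C =
      contradiction (Unique⇒length≤2 !C (Walk-confined R-sym K closed ≢r walk (Any.map (inj₁ ∘ sym) p∈C))) (<⇒≱ 3≤)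
      where ≢r = All.map ≢-sym (All.¬Any⇒All¬ (v ∷ vs) r∉C)
    ... | yes r∈C with ∈-∃++ r∈C
    ... | pre , post , eq with Cycle-rotate pre (r ∷ post) (subst Cycle eq c)
    ... | _ , (r∉ ∷ !xs) , walk′ , _ = begin
      length (v ∷ vs)              ≡⟨ cong length eq ⟩
      length (pre ++ r ∷ post)     ≡⟨ length-++-comm pre (r ∷ post) ⟩
      suc (length (post ++ pre))   ≤⟨ s≤s (Unique⇒length≤2 !xs (tail-confined walk′ (All.map ≢-sym r∉) p∈xs)) ⟩
      3                            ∎
      where
      open ≤-Reasoning
      p∈xs : p ∈ post ++ pre
      p∈xs with ∈-++⁻ pre (subst (p ∈_) eq p∈C)
      ... | inj₁ p∈pre         = ∈-++⁺ʳ post p∈pre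
      ... | inj₂ (here p≡r)    = contradiction p≡r p≢r
      ... | inj₂ (there p∈post) = ∈-++⁺ˡ p∈post

last∈ : ∀ {V : Set} (x : V) xs → last x xs ∈ x ∷ xs
last∈ x []       = here refl
last∈ x (y ∷ ys) = there (last∈ y ys)

Cycle-mono : ∀ {V} {R R′ : Rel V 0ℓ} {C} → (∀ {x y} → x ∈ C → y ∈ C → R x y → R′ x y) → Cycle R C → Cycle R′ C
Cycle-mono {R = R} {R′} {C = v ∷ vs} R⇒R′ (3≤ , !C , walk , closing) =
  3≤ , !C , Walk-mono R⇒R′ walk , R⇒R′ (last∈ v vs) (here refl) closing
  where
  Walk-mono : ∀ {xs} → (∀ {x y} → x ∈ xs → y ∈ xs → R x y → R′ x y) → Walk R xs → Walk R′ xs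
  Walk-mono R⇒R′ (end v)  = end v
  Walk-mono R⇒R′ (e ∷ w) = R⇒R′ (here refl) (there (here refl)) e ∷ Walk-mono (λ x∈ y∈ → R⇒R′ (there x∈) (there y∈)) w

IsCycle⇒Cycle : ∀ {n} {A : Adj n} {R : Rel ℕ 0ℓ} → (∀ {x y} → A x y ≡ true → R (toℕ x) (toℕ y)) →
  ∀ {cs} → IsCycle A cs → Cycle R (map toℕ cs)
IsCycle⇒Cycle {A = A} {R} A⇒R {v ∷ vs} (3≤ , !cs , walk , closing) =
  subst (3 ≤_) (sym (length-map toℕ (v ∷ vs))) 3≤ ,
  Unique.map⁺ toℕ-injective !cs ,
  map-walk walk ,
  subst (λ z → R z (toℕ v)) (sym (last-map v vs)) (A⇒R closing)
  where
  map-walk : ∀ {xs} → IsWalk A xs → Walk R (map toℕ xs)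
  map-walk (single v)      = end (toℕ v)
  map-walk (step _ _ _ e w) = A⇒R e ∷ map-walk w

  last-map : ∀ x xs → last (toℕ x) (map toℕ xs) ≡ toℕ (last x xs)
  last-map x []       = refl
  last-map x (y ∷ ys) = last-map y ys

Triple : Set
Triple = ℕ × ℕ × ℕ

_∈ᵥ_ : ℕ → Triple → Set
z ∈ᵥ (a , b , c) = z ≡ a ⊎ z ≡ b ⊎ z ≡ c

_∈ᵥ?_ : ∀ z t → Dec (z ∈ᵥ t)
z ∈ᵥ? (a , b , c) = z ≟ a ⊎-dec z ≟ b ⊎-dec z ≟ c

EdgeOf : Triple → Rel ℕ 0ℓ
EdgeOf t i j = i ∈ᵥ t × j ∈ᵥ t × i ≢ j

_≟³_ : DecidableEquality Triple
_≟³_ = ≡-dec _≟_ (≡-dec _≟_ _≟_)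

Below : ℕ → Triple → Set
Below n t = ∀ {z} → z ∈ᵥ t → z < n

Sorted : Triple → Set
Sorted (a , b , c) = a < b × b < c

IsTriangle : Rel ℕ 0ℓ → Triple → Set
IsTriangle R (a , b , c) = a < b × b < c × R a b × R b c × R a c

isTriangle? : {R : Rel ℕ 0ℓ} → Decidable R → Decidable₁ (IsTriangle R)
isTriangle? R? (a , b , c) = a <? b ×-dec b <? c ×-dec R? a b ×-dec R? b c ×-dec R? a c

IsTriangle⇒Sorted : ∀ {t} R → IsTriangle R t → Sorted t
IsTriangle⇒Sorted _ (a<b , b<c , _) = a<b , b<c

IsTriangle-mono : ∀ {R R′ t} → (∀ {i j} → i ∈ᵥ t → j ∈ᵥ t → R i j → R′ i j) → IsTriangle R t → IsTriangle R′ t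
IsTriangle-mono R⇒R′ (a<b , b<c , ab , bc , ac) =
  a<b , b<c ,
  R⇒R′ (inj₁ refl) (inj₂ (inj₁ refl)) ab , R⇒R′ (inj₂ (inj₁ refl)) (inj₂ (inj₂ refl)) bc , R⇒R′ (inj₁ refl) (inj₂ (inj₂ refl)) ac

triangle-edge : ∀ {R t i j} → Symmetric R → IsTriangle R t → EdgeOf t i j → R i j
triangle-edge R-sym (_ , _ , ab , bc , ac) (inj₁ refl        , inj₁ refl        , i≢j) = contradiction refl i≢j
triangle-edge R-sym (_ , _ , ab , bc , ac) (inj₁ refl        , inj₂ (inj₁ refl) , _)   = ab
triangle-edge R-sym (_ , _ , ab , bc , ac) (inj₁ refl        , inj₂ (inj₂ refl) , _)   = ac
triangle-edge R-sym (_ , _ , ab , bc , ac) (inj₂ (inj₁ refl) , inj₁ refl        , _)   = R-sym ab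
triangle-edge R-sym (_ , _ , ab , bc , ac) (inj₂ (inj₁ refl) , inj₂ (inj₁ refl) , i≢j) = contradiction refl i≢j
triangle-edge R-sym (_ , _ , ab , bc , ac) (inj₂ (inj₁ refl) , inj₂ (inj₂ refl) , _)   = bc
triangle-edge R-sym (_ , _ , ab , bc , ac) (inj₂ (inj₂ refl) , inj₁ refl        , _)   = R-sym ac
triangle-edge R-sym (_ , _ , ab , bc , ac) (inj₂ (inj₂ refl) , inj₂ (inj₁ refl) , _)   = R-sym bc
triangle-edge R-sym (_ , _ , ab , bc , ac) (inj₂ (inj₂ refl) , inj₂ (inj₂ refl) , i≢j) = contradiction refl i≢j

triangle-corner-edge : ∀ {R t z} → Symmetric R → IsTriangle R t → z ∈ᵥ t → ∃[ k ] R z k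
triangle-corner-edge R-sym (_ , _ , ab , bc , ac) (inj₁ refl)        = _ , ab
triangle-corner-edge R-sym (_ , _ , ab , bc , ac) (inj₂ (inj₁ refl)) = _ , bc
triangle-corner-edge R-sym (_ , _ , ab , bc , ac) (inj₂ (inj₂ refl)) = _ , R-sym ac

sorted-⊆ : ∀ {s t} → Sorted s → Sorted t → (∀ {z} → z ∈ᵥ s → z ∈ᵥ t) → s ≡ t
sorted-⊆ {x , y , z} {a , b , c} (x<y , y<z) (a<b , b<c) s⊆t = cong₂ _,_ x≡a (cong₂ _,_ y≡b z≡c)
  where
  a≤ : ∀ {k} → k ∈ᵥ (a , b , c) → a ≤ k
  a≤ (inj₁ refl)        = ≤-refl
  a≤ (inj₂ (inj₁ refl)) = <⇒≤ a<b
  a≤ (inj₂ (inj₂ refl)) = <⇒≤ (<-trans a<b b<c)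

  ≤c : ∀ {k} → k ∈ᵥ (a , b , c) → k ≤ c
  ≤c (inj₁ refl)        = <⇒≤ (<-trans a<b b<c)
  ≤c (inj₂ (inj₁ refl)) = <⇒≤ b<c
  ≤c (inj₂ (inj₂ refl)) = ≤-refl

  y≡b : y ≡ b
  y≡b with s⊆t (inj₂ (inj₁ refl))
  ... | inj₁ refl        = contradiction (a≤ (s⊆t (inj₁ refl))) (<⇒≱ x<y)
  ... | inj₂ (inj₁ y≡b)  = y≡b
  ... | inj₂ (inj₂ refl) = contradiction (≤c (s⊆t (inj₂ (inj₂ refl)))) (<⇒≱ y<z)

  x≡a : x ≡ a
  x≡a with s⊆t (inj₁ refl)
  ... | inj₁ x≡a         = x≡a
  ... | inj₂ (inj₁ refl) = contradiction y≡b (>⇒≢ x<y)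
  ... | inj₂ (inj₂ refl) = contradiction (<-trans (subst (_< x) (sym y≡b) b<c) x<y) (<-irrefl refl)

  z≡c : z ≡ c
  z≡c with s⊆t (inj₂ (inj₂ refl))
  ... | inj₁ refl        = contradiction (<-trans (subst (a <_) (sym y≡b) a<b) y<z) (<-irrefl refl)
  ... | inj₂ (inj₁ refl) = contradiction y≡b (<⇒≢ y<z)
  ... | inj₂ (inj₂ z≡c)  = z≡c

third-corner : ∀ {t i j} → Sorted t → EdgeOf t i j → ∃[ k ] k ∈ᵥ t × k ≢ i × k ≢ j
third-corner _           (inj₁ refl        , inj₁ refl        , i≢j) = contradiction refl i≢j
third-corner (a<b , b<c) (inj₁ refl        , inj₂ (inj₁ refl) , _)   = _ , inj₂ (inj₂ refl) , >⇒≢ (<-trans a<b b<c) , >⇒≢ b<c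
third-corner (a<b , b<c) (inj₁ refl        , inj₂ (inj₂ refl) , _)   = _ , inj₂ (inj₁ refl) , >⇒≢ a<b , <⇒≢ b<c
third-corner (a<b , b<c) (inj₂ (inj₁ refl) , inj₁ refl        , _)   = _ , inj₂ (inj₂ refl) , >⇒≢ b<c , >⇒≢ (<-trans a<b b<c)
third-corner _           (inj₂ (inj₁ refl) , inj₂ (inj₁ refl) , i≢j) = contradiction refl i≢j
third-corner (a<b , b<c) (inj₂ (inj₁ refl) , inj₂ (inj₂ refl) , _)   = _ , inj₁ refl , <⇒≢ a<b , <⇒≢ (<-trans a<b b<c)
third-corner (a<b , b<c) (inj₂ (inj₂ refl) , inj₁ refl        , _)   = _ , inj₂ (inj₁ refl) , <⇒≢ b<c , >⇒≢ a<b
third-corner (a<b , b<c) (inj₂ (inj₂ refl) , inj₂ (inj₁ refl) , _)   = _ , inj₁ refl , <⇒≢ (<-trans a<b b<c) , <⇒≢ a<b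
third-corner _           (inj₂ (inj₂ refl) , inj₂ (inj₂ refl) , i≢j) = contradiction refl i≢j

Fin³ : ℕ → Set
Fin³ n = Fin n × Fin n × Fin n

toℕ³ : ∀ {n} → Fin³ n → Triple
toℕ³ (a , b , c) = toℕ a , toℕ b , toℕ c

toℕ³-injective : ∀ {n} {x y : Fin³ n} → toℕ³ x ≡ toℕ³ y → x ≡ y
toℕ³-injective {x = a , b , c} {a′ , b′ , c′} eq
  with refl ← toℕ-injective (cong proj₁ eq)
     | refl ← toℕ-injective (cong (proj₁ ∘ proj₂) eq)
     | refl ← toℕ-injective (cong (proj₂ ∘ proj₂) eq) = refl

toℕ³-onto : ∀ {n t} → Below n t → ∃[ x ] toℕ³ {n} x ≡ t
toℕ³-onto {t = a , b , c} below = (fromℕ< a<n , fromℕ< b<n , fromℕ< c<n) ,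
  cong₂ _,_ (toℕ-fromℕ< a<n) (cong₂ _,_ (toℕ-fromℕ< b<n) (toℕ-fromℕ< c<n))
  where
  a<n = below (inj₁ refl)
  b<n = below (inj₂ (inj₁ refl))
  c<n = below (inj₂ (inj₂ refl))

cartesianProductWith≡concatMap : ∀ {A B C : Set} (f : A → B → C) xs ys →
  cartesianProductWith f xs ys ≡ concatMap (λ x → map (f x) ys) xs
cartesianProductWith≡concatMap f []       ys = refl
cartesianProductWith≡concatMap f (x ∷ xs) ys = cong (map (f x) ys ++_) (cartesianProductWith≡concatMap f xs ys)

triples≡cartesianProduct : ∀ n → triples n ≡ cartesianProduct (allFin n) (cartesianProduct (allFin n) (allFin n))
triples≡cartesianProduct n = sym (begin
  cartesianProduct Fs (cartesianProduct Fs Fs)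
    ≡⟨ cartesianProductWith≡concatMap _,_ Fs _ ⟩
  concatMap (λ a → map (a ,_) (cartesianProduct Fs Fs)) Fs
    ≡⟨ concatMap-cong (λ a → cong (map (a ,_)) (cartesianProductWith≡concatMap _,_ Fs Fs)) Fs ⟩
  concatMap (λ a → map (a ,_) (concatMap (λ b → map (b ,_) Fs) Fs)) Fs
    ≡⟨ concatMap-cong (λ a → map-concatMap (a ,_) (λ b → map (b ,_) Fs) Fs) Fs ⟩
  concatMap (λ a → concatMap (λ b → map (a ,_) (map (b ,_) Fs)) Fs) Fs
    ≡⟨ concatMap-cong (λ a → concatMap-cong (λ b → sym (map-∘ Fs)) Fs) Fs ⟩
  triples n ∎)
  where
  open ≡-Reasoning
  Fs = allFin n

triples-unique : ∀ n → Unique (triples n)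
triples-unique n rewrite triples≡cartesianProduct n =
  Unique.cartesianProduct⁺ (Unique.allFin⁺ n) (Unique.cartesianProduct⁺ (Unique.allFin⁺ n) (Unique.allFin⁺ n))

∈-triples : ∀ {n} (x : Fin³ n) → x ∈ triples n
∈-triples {n} (a , b , c) rewrite triples≡cartesianProduct n =
  ∈-cartesianProduct⁺ (∈-allFin a) (∈-cartesianProduct⁺ (∈-allFin b) (∈-allFin c))

count-toℕ³≡ : ∀ {n t} → Below n t → count (λ x → toℕ³ x ≟³ t) (triples n) ≡ 1
count-toℕ³≡ {n} below with toℕ³-onto {n} below
... | x₀ , x₀↦t =
  count-unique (λ x → toℕ³ x ≟³ _) (triples-unique n) (∈-triples x₀) x₀↦t (λ x↦t → toℕ³-injective (trans x↦t (sym x₀↦t)))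

T-isTriangle : ∀ {n} (A : Adj n) {R : Rel ℕ 0ℓ} → (∀ x y → T (A x y) ⇔ R (toℕ x) (toℕ y)) →
  ∀ x → T (isTriangle A x) ⇔ IsTriangle R (toℕ³ x)
T-isTriangle A A⇔R (a , b , c) =
  ⇔-trans T-∧ (T<ᵇ ×-⇔ ⇔-trans T-∧ (T<ᵇ ×-⇔ ⇔-trans T-∧ (A⇔R a b ×-⇔ ⇔-trans T-∧ (A⇔R b c ×-⇔ A⇔R a c))))
  where
  T<ᵇ : ∀ {m n} → T (m <ᵇ n) ⇔ m < n
  T<ᵇ {m} {n} = mk⇔ (<ᵇ⇒< m n) <⇒<ᵇ

triangleCount≡count : ∀ {n} (A : Adj n) {R : Rel ℕ 0ℓ} (R? : Decidable R) → (∀ x y → T (A x y) ⇔ R (toℕ x) (toℕ y)) →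
  triangleCount A ≡ count (isTriangle? R? ∘ toℕ³) (triples n)
triangleCount≡count {n} A {R} R? A⇔R = count-≐ (T? ∘ isTriangle A) (isTriangle? R? ∘ toℕ³)
  ((λ {x} → Equivalence.to (T-isTriangle A {R} A⇔R x)) , (λ {x} → Equivalence.from (T-isTriangle A {R} A⇔R x))) (triples n)

-- Cactus lists of triangles

_∈V_ : ℕ → List Triple → Set
z ∈V L = Any (z ∈ᵥ_) L

Edge : List Triple → Rel ℕ 0ℓ
Edge L i j = Any (λ t → EdgeOf t i j) L

edge? : ∀ L → Decidable (Edge L)
edge? L i j = any? (λ t → i ∈ᵥ? t ×-dec j ∈ᵥ? t ×-dec ¬? (i ≟ j)) L

Edge-sym : ∀ {L} → Symmetric (Edge L)
Edge-sym = Any.map (λ (i∈t , j∈t , i≢j) → j∈t , i∈t , ≢-sym i≢j)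

Edge-irrefl : ∀ {L i} → ¬ Edge L i i
Edge-irrefl e with (_ , _ , _ , i≢i) ← Any.satisfied e = i≢i refl

Edge⇒∈V : ∀ {L i j} → Edge L i j → i ∈V L
Edge⇒∈V = Any.map proj₁

data TwoCorners (F : Pred ℕ 0ℓ) : Triple → Set where
  corners₁₂ : ∀ {a b c} → F a → F b → TwoCorners F (a , b , c)
  corners₁₃ : ∀ {a b c} → F a → F c → TwoCorners F (a , b , c)
  corners₂₃ : ∀ {a b c} → F b → F c → TwoCorners F (a , b , c)

TwoCorners-map : ∀ {F G t} → (∀ {z} → z ∈ᵥ t → F z → G z) → TwoCorners F t → TwoCorners G t
TwoCorners-map F⇒G (corners₁₂ Fa Fb) = corners₁₂ (F⇒G (inj₁ refl) Fa) (F⇒G (inj₂ (inj₁ refl)) Fb)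
TwoCorners-map F⇒G (corners₁₃ Fa Fc) = corners₁₃ (F⇒G (inj₁ refl) Fa) (F⇒G (inj₂ (inj₂ refl)) Fc)
TwoCorners-map F⇒G (corners₂₃ Fb Fc) = corners₂₃ (F⇒G (inj₂ (inj₁ refl)) Fb) (F⇒G (inj₂ (inj₂ refl)) Fc)

New : Pred ℕ 0ℓ → List Triple → Pred ℕ 0ℓ
New X L z = ¬ (X z ⊎ z ∈V L)

-- Read from the end, every triangle is hung at a single vertex onto X and the triangles
-- before it, so the triangles form a triangular cactus that can be glued onto any cactus containing X.
data Cactus (X : Pred ℕ 0ℓ) : List Triple → Set where
  []  : Cactus X []
  _∷_ : ∀ {t L} → TwoCorners (New X L) t → Cactus X L → Cactus X (t ∷ L)

Cactus-weaken : ∀ {X Y L} → (∀ {z} → z ∈V L → Y z → X z) → Cactus X L → Cactus Y L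
Cactus-weaken Y⇒X []             = []
Cactus-weaken Y⇒X (new ∷ cactus) =
  TwoCorners-map (λ z∈t new-z → new-z ∘ map₁ (Y⇒X (here z∈t))) new ∷ Cactus-weaken (Y⇒X ∘ there) cactus

Cactus-++ : ∀ {X Y L₁ L₂} → Cactus X L₁ → Cactus Y L₂ → (∀ {z} → z ∈V L₂ → X z ⊎ z ∈V L₁ → Y z) →
  Cactus X (L₂ ++ L₁)
Cactus-++ c₁ []                           old⇒Y = c₁
Cactus-++ {X} {Y} {L₁} c₁ (_∷_ {t} {L₂} new c₂) old⇒Y = TwoCorners-map still-new new ∷ Cactus-++ c₁ c₂ (old⇒Y ∘ there)
  where
  still-new : ∀ {z} → z ∈ᵥ t → New Y L₂ z → New X (L₂ ++ L₁) z
  still-new z∈t new-z (inj₁ Xz) = new-z (inj₁ (old⇒Y (here z∈t) (inj₁ Xz)))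
  still-new z∈t new-z (inj₂ z∈L) with ++⁻ L₂ z∈L
  ... | inj₁ z∈L₂ = new-z (inj₂ z∈L₂)
  ... | inj₂ z∈L₁ = new-z (inj₁ (old⇒Y (here z∈t) (inj₂ z∈L₁)))

Cactus-drop : ∀ {X L} k → Cactus X L → Cactus X (drop k L)
Cactus-drop zero    cactus         = cactus
Cactus-drop (suc k) []             = []
Cactus-drop (suc k) (_ ∷ cactus)   = Cactus-drop k cactus

record Pendant (F : Pred ℕ 0ℓ) (t : Triple) : Set where
  field
    p q r   : ℕ
    to-pqr   : ∀ {z} → z ∈ᵥ t → z ∈ᵥ (p , q , r)
    from-pqr : ∀ {z} → z ∈ᵥ (p , q , r) → z ∈ᵥ t
    p≢r     : p ≢ r
    q≢r     : q ≢ r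
    Fp      : F p
    Fq      : F q

pendant : ∀ {F t} → Sorted t → TwoCorners F t → Pendant F t
pendant (a<b , b<c) (corners₁₂ Fa Fb) = record
  { to-pqr = λ z∈ → z∈ ; from-pqr = λ z∈ → z∈ ; p≢r = <⇒≢ (<-trans a<b b<c) ; q≢r = <⇒≢ b<c ; Fp = Fa ; Fq = Fb }
pendant (a<b , b<c) (corners₁₃ Fa Fc) = record
  { to-pqr = map₂ swap ; from-pqr = map₂ swap ; p≢r = <⇒≢ a<b ; q≢r = >⇒≢ b<c ; Fp = Fa ; Fq = Fc }
pendant (a<b , b<c) (corners₂₃ Fb Fc) = record
  { to-pqr = assocʳ ∘ swap ; from-pqr = swap ∘ assocˡ ; p≢r = >⇒≢ a<b ; q≢r = >⇒≢ (<-trans a<b b<c) ; Fp = Fb ; Fq = Fc }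

Pendant-swap : ∀ {F t} → Pendant F t → Pendant F t
Pendant-swap P = record
  { to-pqr = swap-pq ∘ to-pqr ; from-pqr = from-pqr ∘ swap-pq ; p≢r = q≢r ; q≢r = p≢r ; Fp = Fq ; Fq = Fp }
  where
  open Pendant P
  swap-pq : ∀ {z x y w} → z ∈ᵥ (x , y , w) → z ∈ᵥ (y , x , w)
  swap-pq = assocʳ ∘ map₁ swap ∘ assocˡ

module _ {X L t} (P : Pendant (New X L) t) where
  open Pendant P

  pendant-neighbour : ∀ {y} → Edge (t ∷ L) p y → y ≡ q ⊎ y ≡ r
  pendant-neighbour (here (_ , y∈t , p≢y)) with to-pqr y∈t
  ... | inj₁ y≡p  = contradiction (sym y≡p) p≢y
  ... | inj₂ y∈qr = y∈qr
  pendant-neighbour (there e) = contradiction (inj₂ (Edge⇒∈V e)) Fp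

  Edge-avoiding : ∀ {x y} → x ≢ p → x ≢ q → y ≢ p → y ≢ q → Edge (t ∷ L) x y → Edge L x y
  Edge-avoiding x≢p x≢q y≢p y≢q (here (x∈t , y∈t , x≢y)) =
    contradiction (trans (is-r x∈t x≢p x≢q) (sym (is-r y∈t y≢p y≢q))) x≢y
    where
    is-r : ∀ {z} → z ∈ᵥ t → z ≢ p → z ≢ q → z ≡ r
    is-r z∈t z≢p z≢q with to-pqr z∈t
    ... | inj₁ z≡p        = contradiction z≡p z≢p
    ... | inj₂ (inj₁ z≡q) = contradiction z≡q z≢q
    ... | inj₂ (inj₂ z≡r) = z≡r
  Edge-avoiding _ _ _ _ (there e) = e

  pendant-triangle : ∀ {s} → IsTriangle (Edge (t ∷ L)) s → p ∈ᵥ s → ∀ {k} → k ∈ᵥ s → k ∈ᵥ t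
  pendant-triangle tri p∈s {k} k∈s with k ≟ p
  ... | yes refl = from-pqr (inj₁ refl)
  ... | no k≢p   = from-pqr (inj₂ (pendant-neighbour (triangle-edge Edge-sym tri (p∈s , k∈s , ≢-sym k≢p))))

  pendant-not-old : ¬ IsTriangle (Edge L) t
  pendant-not-old tri = Fp (inj₂ (Edge⇒∈V (proj₂ (triangle-corner-edge Edge-sym tri (from-pqr (inj₁ refl))))))

∉⇒≢ : ∀ {A : Set} {P : A → Set} {x y : A} → P x → ¬ P y → x ≢ y
∉⇒≢ Px ¬Py refl = ¬Py Px

Cactus-cycles : ∀ {X L} → Cactus X L → All Sorted L → ∀ {C} → Cycle (Edge L) C → length C ≡ 3
Cactus-cycles [] [] {_ ∷ _} (_ , _ , _ , ())
Cactus-cycles {L = t ∷ L} (new ∷ cactus) (sorted ∷ sorteds) {C} c with pendant sorted new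
... | P with Pendant.p P ∈? C | Pendant.q P ∈? C
... | yes p∈C | _ =
  cycle-through-pendant (Edge (t ∷ L)) _≟_ Edge-sym (Pendant.p≢r P) (pendant-neighbour P) (pendant-neighbour (Pendant-swap P)) c p∈C
... | no _ | yes q∈C =
  cycle-through-pendant (Edge (t ∷ L)) _≟_ Edge-sym (Pendant.q≢r P) (pendant-neighbour (Pendant-swap P)) (pendant-neighbour P) c q∈C
... | no p∉C | no q∉C = Cactus-cycles cactus sorteds (Cycle-mono avoiding c)
  where
  avoiding : ∀ {x y} → x ∈ C → y ∈ C → Edge (t ∷ L) x y → Edge L x y
  avoiding x∈C y∈C = Edge-avoiding P (∉⇒≢ x∈C p∉C) (∉⇒≢ x∈C q∉C) (∉⇒≢ y∈C p∉C) (∉⇒≢ y∈C q∉C)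

triangle-∷ : ∀ {X t L s} → TwoCorners (New X L) t → Sorted t → IsTriangle (Edge (t ∷ L)) s → s ≡ t ⊎ IsTriangle (Edge L) s
triangle-∷ {t = t} {L} {s} new sorted tri with pendant sorted new
... | P with Pendant.p P ∈ᵥ? s | Pendant.q P ∈ᵥ? s
... | yes p∈s | _       = inj₁ (sorted-⊆ (IsTriangle⇒Sorted (Edge (t ∷ L)) tri) sorted (pendant-triangle P tri p∈s))
... | no _    | yes q∈s = inj₁ (sorted-⊆ (IsTriangle⇒Sorted (Edge (t ∷ L)) tri) sorted (pendant-triangle (Pendant-swap P) tri q∈s))
... | no p∉s  | no q∉s  = inj₂ (IsTriangle-mono avoiding tri)
  where
  avoiding : ∀ {i j} → i ∈ᵥ s → j ∈ᵥ s → Edge (t ∷ L) i j → Edge L i j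
  avoiding i∈s j∈s = Edge-avoiding P (∉⇒≢ i∈s p∉s) (∉⇒≢ i∈s q∉s) (∉⇒≢ j∈s p∉s) (∉⇒≢ j∈s q∉s)

triangle-self : ∀ {t L} → Sorted t → IsTriangle (Edge (t ∷ L)) t
triangle-self (a<b , b<c) =
  a<b , b<c , here (inj₁ refl , inj₂ (inj₁ refl) , <⇒≢ a<b) , here (inj₂ (inj₁ refl) , inj₂ (inj₂ refl) , <⇒≢ b<c) ,
  here (inj₁ refl , inj₂ (inj₂ refl) , <⇒≢ (<-trans a<b b<c))

Cactus-triangleCount : ∀ {n X L} → Cactus X L → All Sorted L → All (Below n) L →
  count (isTriangle? (edge? L) ∘ toℕ³) (triples n) ≡ length L
Cactus-triangleCount {n} [] [] [] = count-∅ (isTriangle? (edge? []) ∘ toℕ³) (λ { _ (_ , _ , () , _) }) (triples n)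
Cactus-triangleCount {n} {L = t ∷ L} (new ∷ cactus) (sorted ∷ sorteds) (below ∷ belows) = begin
  count (isTriangle? (edge? (t ∷ L)) ∘ toℕ³) (triples n)
    ≡⟨ count-≐ _ (is-t? ∪? old?) (triangle-∷ new sorted , merge) (triples n) ⟩
  count (is-t? ∪? old?) (triples n)
    ≡⟨ count-∪ is-t? old? (λ { refl → pendant-not-old (pendant sorted new) }) (triples n) ⟩
  count is-t? (triples n) + count old? (triples n)
    ≡⟨ cong₂ _+_ (count-toℕ³≡ below) (Cactus-triangleCount cactus sorteds belows) ⟩
  suc (length L) ∎
  where
  open ≡-Reasoning
  is-t? : Decidable₁ (λ (x : Fin³ n) → toℕ³ x ≡ t)
  is-t? x = toℕ³ x ≟³ t
  old? : Decidable₁ (IsTriangle (Edge L) ∘ toℕ³)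
  old? = isTriangle? (edge? L) ∘ toℕ³
  merge : ∀ {x} → toℕ³ x ≡ t ⊎ IsTriangle (Edge L) (toℕ³ x) → IsTriangle (Edge (t ∷ L)) (toℕ³ x)
  merge (inj₁ refl) = triangle-self sorted
  merge (inj₂ tri)  = IsTriangle-mono {Edge L} (λ _ _ → there) tri

cactusAdj : ∀ {n} → List Triple → Adj n
cactusAdj L x y = ⌊ edge? L (toℕ x) (toℕ y) ⌋

module _ {n : ℕ} (L : List Triple) where

  T-cactusAdj : ∀ (x y : Fin n) → T (cactusAdj L x y) ⇔ Edge L (toℕ x) (toℕ y)
  T-cactusAdj x y = mk⇔ toWitness fromWitness

  cactusAdj⇒Edge : ∀ {x y : Fin n} → cactusAdj L x y ≡ true → Edge L (toℕ x) (toℕ y)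
  cactusAdj⇒Edge {x} {y} e = Equivalence.to (T-cactusAdj x y) (Equivalence.from T-≡ e)

  Edge⇒cactusAdj : ∀ {x y : Fin n} → Edge L (toℕ x) (toℕ y) → cactusAdj L x y ≡ true
  Edge⇒cactusAdj {x} {y} e = Equivalence.to T-≡ (Equivalence.from (T-cactusAdj x y) e)

  cactusAdj-simple : IsSimpleGraph (cactusAdj {n} L)
  cactusAdj-simple = record
    { symm   = λ a b → let ab? = edge? L (toℕ a) (toℕ b) ; ba? = edge? L (toℕ b) (toℕ a) in
                 trans (isYes≗does ab?) (trans (does-⇔ (mk⇔ Edge-sym Edge-sym) ab? ba?) (sym (isYes≗does ba?)))
    ; irrefl = λ a → trans (isYes≗does (edge? L (toℕ a) (toℕ a))) (dec-false (edge? L (toℕ a) (toℕ a)) (Edge-irrefl {L}))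
    }

  cactusAdj-⊆ : ∀ {H : Adj n} {R : Rel ℕ 0ℓ} → Symmetric R → All (IsTriangle R) L →
    (∀ {x y} → R (toℕ x) (toℕ y) → H x y ≡ true) → cactusAdj L ⊆G H
  cactusAdj-⊆ {R = R} R-sym triangles R⇒H a b e with All.lookupAny triangles (cactusAdj⇒Edge e)
  ... | triangle , edge = R⇒H (triangle-edge {R} R-sym triangle edge)

  module _ {X : Pred ℕ 0ℓ} (cactus : Cactus X L) (sorted : All Sorted L) (below : All (Below n) L) where

    cactusAdj-edgeOnCycle : ∀ u v → cactusAdj L u v ≡ true → EdgeOnCycle (cactusAdj L) u v
    cactusAdj-edgeOnCycle u v e with find (cactusAdj⇒Edge e)
    ... | t , t∈L , uv@(u∈t , v∈t , u≢v) with third-corner (All.lookup sorted t∈L) uv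
    ... | k , k∈t , k≢u , k≢v = w ∷ [] , s≤s (s≤s (s≤s z≤n)) , distinct , step u v _ e (step v w _ vw (single w)) , wu
      where
      w = fromℕ< (All.lookup below t∈L k∈t)
      w∈t : toℕ w ∈ᵥ t
      w∈t = subst (_∈ᵥ t) (sym (toℕ-fromℕ< _)) k∈t
      w≢u : toℕ w ≢ toℕ u
      w≢u = subst (_≢ toℕ u) (sym (toℕ-fromℕ< _)) k≢u
      w≢v : toℕ w ≢ toℕ v
      w≢v = subst (_≢ toℕ v) (sym (toℕ-fromℕ< _)) k≢v
      vw = Edge⇒cactusAdj (lose t∈L (v∈t , w∈t , ≢-sym w≢v))
      wu = Edge⇒cactusAdj (lose t∈L (w∈t , u∈t , w≢u))
      distinct : Unique (u ∷ v ∷ w ∷ [])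
      distinct = ((u≢v ∘ cong toℕ) ∷ (≢-sym w≢u ∘ cong toℕ) ∷ []) ∷ ((≢-sym w≢v ∘ cong toℕ) ∷ []) ∷ [] ∷ []

    cactusAdj-isTriangularCactus : IsTriangularCactus (cactusAdj L)
    cactusAdj-isTriangularCactus = record
      { simple         = cactusAdj-simple
      ; cyclesTriangle = λ cs c → trans (sym (length-map toℕ cs)) (Cactus-cycles cactus sorted (IsCycle⇒Cycle cactusAdj⇒Edge c))
      ; edgesOnCycle   = cactusAdj-edgeOnCycle
      }

    cactusAdj-triangleCount : triangleCount (cactusAdj {n} L) ≡ length L
    cactusAdj-triangleCount = trans (triangleCount≡count (cactusAdj L) (edge? L) T-cactusAdj)
      (Cactus-triangleCount cactus sorted below)

⌈m+n/2⌉≤⌈m/2⌉+⌈n/2⌉ : ∀ m n → ⌈ m + n /2⌉ ≤ ⌈ m /2⌉ + ⌈ n /2⌉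
⌈m+n/2⌉≤⌈m/2⌉+⌈n/2⌉ zero          n = ≤-refl
⌈m+n/2⌉≤⌈m/2⌉+⌈n/2⌉ (suc zero)    n = s≤s (⌊n/2⌋≤⌈n/2⌉ n)
⌈m+n/2⌉≤⌈m/2⌉+⌈n/2⌉ (suc (suc m)) n = s≤s (⌈m+n/2⌉≤⌈m/2⌉+⌈n/2⌉ m n)

⌊m+n/2⌋≤⌈m/2⌉+⌊n/2⌋ : ∀ m n → ⌊ m + n /2⌋ ≤ ⌈ m /2⌉ + ⌊ n /2⌋
⌊m+n/2⌋≤⌈m/2⌉+⌊n/2⌋ zero          n = ≤-refl
⌊m+n/2⌋≤⌈m/2⌉+⌊n/2⌋ (suc zero)    n = ⌊n/2⌋-mono (n≤1+n (suc n))
⌊m+n/2⌋≤⌈m/2⌉+⌊n/2⌋ (suc (suc m)) n = s≤s (⌊m+n/2⌋≤⌈m/2⌉+⌊n/2⌋ m n)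

⌈1+m+n/2⌉≤⌈m/2⌉+⌈n/2⌉⊎1+⌊m/2⌋+⌊n/2⌋ : ∀ m n →
  ⌈ suc (m + n) /2⌉ ≤ ⌈ m /2⌉ + ⌈ n /2⌉ ⊎ ⌈ suc (m + n) /2⌉ ≤ suc (⌊ m /2⌋ + ⌊ n /2⌋)
⌈1+m+n/2⌉≤⌈m/2⌉+⌈n/2⌉⊎1+⌊m/2⌋+⌊n/2⌋ zero          n = inj₂ ≤-refl
⌈1+m+n/2⌉≤⌈m/2⌉+⌈n/2⌉⊎1+⌊m/2⌋+⌊n/2⌋ (suc zero)    n = inj₁ ≤-refl
⌈1+m+n/2⌉≤⌈m/2⌉+⌈n/2⌉⊎1+⌊m/2⌋+⌊n/2⌋ (suc (suc m)) n =
  Sum.map s≤s s≤s (⌈1+m+n/2⌉≤⌈m/2⌉+⌈n/2⌉⊎1+⌊m/2⌋+⌊n/2⌋ m n)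

⌊1+m+n/2⌋≤⌈m/2⌉+⌊n/2⌋⊎⌊m/2⌋+⌈n/2⌉ : ∀ m n →
  ⌊ suc (m + n) /2⌋ ≤ ⌈ m /2⌉ + ⌊ n /2⌋ ⊎ ⌊ suc (m + n) /2⌋ ≤ ⌊ m /2⌋ + ⌈ n /2⌉
⌊1+m+n/2⌋≤⌈m/2⌉+⌊n/2⌋⊎⌊m/2⌋+⌈n/2⌉ zero          n = inj₂ ≤-refl
⌊1+m+n/2⌋≤⌈m/2⌉+⌊n/2⌋⊎⌊m/2⌋+⌈n/2⌉ (suc zero)    n = inj₁ ≤-refl
⌊1+m+n/2⌋≤⌈m/2⌉+⌊n/2⌋⊎⌊m/2⌋+⌈n/2⌉ (suc (suc m)) n =
  Sum.map s≤s s≤s (⌊1+m+n/2⌋≤⌈m/2⌉+⌊n/2⌋⊎⌊m/2⌋+⌈n/2⌉ m n)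

-- Cactus packings in intervals of the outer cycle

module Intervals (n : ℕ) {E : Rel ℕ 0ℓ} (E? : Decidable E) (E-sym : Symmetric E)
  (E-bounded : ∀ {i j} → E i j → i < n) (E-noncrossing : ∀ {a b c d} → a < b → b < c → c < d → E a c → E b d → ⊥) where

  Within : ℕ → ℕ → Triple → Set
  Within u w (a , b , c) = u ≤ a × c ≤ w

  TriangleIn : ℕ → ℕ → Triple → Set
  TriangleIn u w t = IsTriangle E t × Within u w t

  triangleIn? : ∀ u w → Decidable₁ (TriangleIn u w)
  triangleIn? u w t@(a , b , c) = isTriangle? E? t ×-dec (u ≤? a ×-dec c ≤? w)

  #triangles : ℕ → ℕ → ℕ
  #triangles u w = count (triangleIn? u w ∘ toℕ³) (triples n)

  NoNeighbour : ℕ → ℕ → ℕ → Set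
  NoNeighbour u lo hi = ∀ {z} → lo < z → z < hi → ¬ E u z

  NoNeighbour-suc : ∀ {u lo w} → u ≤ lo → ¬ (u < w × E u w) → NoNeighbour u lo w → NoNeighbour u lo (suc w)
  NoNeighbour-suc u≤lo ¬uw none lo<z z<1+w with m<1+n⇒m<n∨m≡n z<1+w
  ... | inj₁ z<w  = none lo<z z<w
  ... | inj₂ refl = λ uw → ¬uw (≤-<-trans u≤lo lo<z , uw)

  largestNeighbour : ∀ u w → NoNeighbour u u w ⊎ ∃[ v ] u < v × v < w × E u v × NoNeighbour u v w
  largestNeighbour u zero = inj₁ (λ _ ())
  largestNeighbour u (suc w) with u <? w ×-dec E? u w
  ... | yes (u<w , uw) = inj₂ (w , u<w , ≤-refl , uw , λ w<z z<1+w → contradiction (≤-pred z<1+w) (<⇒≱ w<z))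
  ... | no ¬uw with largestNeighbour u w
  ...   | inj₁ none                        = inj₁ (NoNeighbour-suc ≤-refl ¬uw none)
  ...   | inj₂ (v , u<v , v<w , uv , none) = inj₂ (v , u<v , m<n⇒m<1+n v<w , uv , NoNeighbour-suc (<⇒≤ u<v) ¬uw none)

  TriangleIn-widen : ∀ {u w u′ w′ t} → u ≤ u′ → w′ ≤ w → TriangleIn u′ w′ t → TriangleIn u w t
  TriangleIn-widen {t = a , b , c} u≤u′ w′≤w (tri , u′≤a , c≤w′) =
    tri , ≤-trans u≤u′ u′≤a , ≤-trans c≤w′ w′≤w

  TriangleIn-empty : ∀ {u w t} → w ≤ u → ¬ TriangleIn u w t
  TriangleIn-empty {t = a , b , c} w≤u ((a<b , b<c , _) , u≤a , c≤w) = <⇒≱ (<-trans a<b b<c) (≤-trans c≤w (≤-trans w≤u u≤a))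

  TriangleIn-disjoint : ∀ {u v w t} → TriangleIn u v t → ¬ TriangleIn v w t
  TriangleIn-disjoint {t = a , b , c} ((a<b , b<c , _) , _ , c≤v) (_ , v≤a , _) = <⇒≱ (<-trans a<b b<c) (≤-trans c≤v v≤a)

  TriangleIn-skip : ∀ {u w t} → NoNeighbour u u w → TriangleIn u w t → TriangleIn (suc u) w t
  TriangleIn-skip {t = a , b , c} none (tri@(a<b , b<c , ab , _) , u≤a , c≤w) with m≤n⇒m<n∨m≡n u≤a
  ... | inj₁ u<a  = tri , u<a , c≤w
  ... | inj₂ refl = contradiction ab (none a<b (<-≤-trans b<c c≤w))

  -- Chords cannot cross uv, and u has no neighbour strictly between v and w.
  TriangleIn-split : ∀ {u v w t} → u < v → v < w → E u v → NoNeighbour u v w → TriangleIn u w t →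
    TriangleIn u v t ⊎ TriangleIn v w t ⊎ t ≡ (u , v , w)
  TriangleIn-split {u} {v} {w} {a , b , c} u<v v<w uv none (tri@(a<b , b<c , ab , bc , ac) , u≤a , c≤w) with c ≤? v | v ≤? a
  ... | yes c≤v | _       = inj₁ (tri , u≤a , c≤v)
  ... | no _    | yes v≤a = inj₂ (inj₁ (tri , v≤a , c≤w))
  ... | no c≰v  | no v≰a  = inj₂ (inj₂ (cong₂ _,_ a≡u (cong₂ _,_ b≡v c≡w)))
    where
    a<v = ≰⇒> v≰a
    v<c = ≰⇒> c≰v

    a≡u : a ≡ u
    a≡u with m≤n⇒m<n∨m≡n u≤a
    ... | inj₁ u<a = ⊥-elim (E-noncrossing u<a a<v v<c uv ac)
    ... | inj₂ u≡a = sym u≡a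

    c≡w : c ≡ w
    c≡w with m≤n⇒m<n∨m≡n c≤w
    ... | inj₁ c<w = contradiction (subst (λ x → E x c) a≡u ac) (none v<c c<w)
    ... | inj₂ c≡w = c≡w

    b≡v : b ≡ v
    b≡v with <-cmp b v
    ... | tri< b<v _ _ = ⊥-elim (E-noncrossing a<b b<v v<c (subst (λ x → E x v) (sym a≡u) uv) bc)
    ... | tri≈ _ b≡v _ = b≡v
    ... | tri> _ _ v<b = contradiction (subst (λ x → E x b) a≡u ab) (none v<b (<-≤-trans b<c c≤w))

  #triangles-empty : ∀ {u w} → w ≤ u → #triangles u w ≡ 0
  #triangles-empty {u} {w} w≤u = count-∅ (triangleIn? u w ∘ toℕ³) (λ _ → TriangleIn-empty w≤u) (triples n)

  #triangles-skip : ∀ {u w} → NoNeighbour u u w → #triangles u w ≡ #triangles (suc u) w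
  #triangles-skip {u} {w} none = count-≐ (triangleIn? u w ∘ toℕ³) (triangleIn? (suc u) w ∘ toℕ³)
    (TriangleIn-skip none , TriangleIn-widen (n≤1+n u) ≤-refl) (triples n)

  module _ {u v w} (u<v : u < v) (v<w : v < w) (uv : E u v) (none : NoNeighbour u v w) where

    private
      sides? : Decidable₁ (λ (x : Fin³ n) → TriangleIn u v (toℕ³ x) ⊎ TriangleIn v w (toℕ³ x))
      sides? = (triangleIn? u v ∘ toℕ³) ∪? (triangleIn? v w ∘ toℕ³)

      from-sides : ∀ {t} → TriangleIn u v t ⊎ TriangleIn v w t → TriangleIn u w t
      from-sides = [ TriangleIn-widen ≤-refl (<⇒≤ v<w) , TriangleIn-widen (<⇒≤ u<v) ≤-refl ]′

      count-sides : count sides? (triples n) ≡ #triangles u v + #triangles v w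
      count-sides = count-∪ (triangleIn? u v ∘ toℕ³) (triangleIn? v w ∘ toℕ³) TriangleIn-disjoint (triples n)

    #triangles-split : ¬ (E u w × E v w) → #triangles u w ≡ #triangles u v + #triangles v w
    #triangles-split ¬fan = trans (count-≐ (triangleIn? u w ∘ toℕ³) sides? (to-sides , from-sides) (triples n)) count-sides
      where
      to-sides : ∀ {t} → TriangleIn u w t → TriangleIn u v t ⊎ TriangleIn v w t
      to-sides tri with TriangleIn-split u<v v<w uv none tri
      ... | inj₁ in-uv        = inj₁ in-uv
      ... | inj₂ (inj₁ in-vw) = inj₂ in-vw
      ... | inj₂ (inj₂ refl) with tri
      ...   | (_ , _ , _ , vw , uw) , _ = contradiction (uw , vw) ¬fan

    #triangles-fan : E u w → E v w → #triangles u w ≡ suc (#triangles u v + #triangles v w)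
    #triangles-fan uw vw = begin
      #triangles u w
        ≡⟨ count-≐ (triangleIn? u w ∘ toℕ³) (sides? ∪? apex?) (to-parts , from-parts) (triples n) ⟩
      count (sides? ∪? apex?) (triples n)
        ≡⟨ count-∪ sides? apex? apex-not-side (triples n) ⟩
      count sides? (triples n) + count apex? (triples n)
        ≡⟨ cong₂ _+_ count-sides (count-toℕ³≡ apex-below) ⟩
      #triangles u v + #triangles v w + 1
        ≡⟨ +-comm _ 1 ⟩
      suc (#triangles u v + #triangles v w) ∎
      where
      open ≡-Reasoning
      apex? : Decidable₁ (λ (x : Fin³ n) → toℕ³ x ≡ (u , v , w))
      apex? x = toℕ³ x ≟³ (u , v , w)

      to-parts : ∀ {t} → TriangleIn u w t → (TriangleIn u v t ⊎ TriangleIn v w t) ⊎ t ≡ (u , v , w)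
      to-parts tri with TriangleIn-split u<v v<w uv none tri
      ... | inj₁ in-uv        = inj₁ (inj₁ in-uv)
      ... | inj₂ (inj₁ in-vw) = inj₁ (inj₂ in-vw)
      ... | inj₂ (inj₂ t≡uvw) = inj₂ t≡uvw

      from-parts : ∀ {t} → (TriangleIn u v t ⊎ TriangleIn v w t) ⊎ t ≡ (u , v , w) → TriangleIn u w t
      from-parts (inj₁ side) = from-sides side
      from-parts (inj₂ refl) = (u<v , v<w , uv , vw , uw) , ≤-refl , ≤-refl

      apex-not-side : ∀ {t} → TriangleIn u v t ⊎ TriangleIn v w t → ¬ t ≡ (u , v , w)
      apex-not-side (inj₁ (_ , _ , w≤v)) refl = <⇒≱ v<w w≤v
      apex-not-side (inj₂ (_ , v≤u , _)) refl = <⇒≱ u<v v≤u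

      apex-below : Below n (u , v , w)
      apex-below (inj₁ refl)        = E-bounded uv
      apex-below (inj₂ (inj₁ refl)) = E-bounded vw
      apex-below (inj₂ (inj₂ refl)) = E-bounded (E-sym uw)

  Interval : ℕ → ℕ → Pred ℕ 0ℓ
  Interval u w z = u ≤ z × z ≤ w

  record Packing (X A : Pred ℕ 0ℓ) (m : ℕ) : Set where
    field
      triangles   : List Triple
      cactus      : Cactus X triangles
      isTriangles : All (IsTriangle E) triangles
      within      : ∀ {z} → z ∈V triangles → A z
      large       : m ≤ length triangles

  Packing-weaken : ∀ {X Y A B m m′} → (∀ {z} → A z → Y z → X z) → (∀ {z} → A z → B z) → m′ ≤ m →
    Packing X A m → Packing Y B m′
  Packing-weaken Y⇒X A⇒B m′≤m P = record
    { triangles   = triangles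
    ; cactus      = Cactus-weaken (Y⇒X ∘ within) cactus
    ; isTriangles = isTriangles
    ; within      = A⇒B ∘ within
    ; large       = ≤-trans m′≤m large
    }
    where open Packing P

  Packing-shrink : ∀ {X A m m′} → m′ ≤ m → Packing X A m → Packing X A m′
  Packing-shrink = Packing-weaken (λ _ x → x) (λ a → a)

  Packing-glue : ∀ {X X₁ X₂ A₁ A₂ m₁ m₂} → Packing X₁ A₁ m₁ → Packing X₂ A₂ m₂ →
    (∀ {z} → A₁ z → X z → X₁ z) → (∀ {z} → A₂ z → X z ⊎ A₁ z → X₂ z) →
    Packing X (λ z → A₁ z ⊎ A₂ z) (m₁ + m₂)
  Packing-glue {m₁ = m₁} {m₂} P₁ P₂ X⇒X₁ old⇒X₂ = record
    { triangles   = P₂.triangles ++ P₁.triangles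
    ; cactus      = Cactus-++ (Cactus-weaken (X⇒X₁ ∘ P₁.within) P₁.cactus) P₂.cactus
                      (λ z∈ → old⇒X₂ (P₂.within z∈) ∘ map₂ P₁.within)
    ; isTriangles = All.++⁺ P₂.isTriangles P₁.isTriangles
    ; within      = [ inj₂ ∘ P₂.within , inj₁ ∘ P₁.within ]′ ∘ ++⁻ P₂.triangles
    ; large       = ≤-trans (+-mono-≤ P₁.large P₂.large)
                      (≤-reflexive (trans (sym (length-++ P₁.triangles)) (length-++-comm P₁.triangles P₂.triangles)))
    }
    where
    module P₁ = Packing P₁
    module P₂ = Packing P₂

  Packing-under : ∀ {X A t m} → Packing (_∈ᵥ t) A m → IsTriangle E t → (∀ {z} → z ∈ᵥ t → A z) →
    TwoCorners (λ z → ¬ X z) t → (∀ {z} → X z → z ∈ᵥ t) → Packing X A (suc m)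
  Packing-under {t = t} {m} P t-triangle t⊆A t-new X⊆t = record
    { triangles   = triangles ++ [ t ]
    ; cactus      = Cactus-++ (TwoCorners-map (λ _ ¬X → [ ¬X , (λ ()) ]′) t-new ∷ []) cactus
                      (λ _ → [ X⊆t , (λ { (here z∈t) → z∈t }) ]′)
    ; isTriangles = All.++⁺ isTriangles (t-triangle ∷ [])
    ; within      = [ within , (λ { (here z∈t) → t⊆A z∈t }) ]′ ∘ ++⁻ triangles
    ; large       = subst (suc m ≤_) (length-++-comm [ t ] triangles) (s≤s large)
    }
    where open Packing P

  Ends : ℕ → ℕ → Pred ℕ 0ℓ
  Ends u w z = z ≡ u ⊎ z ≡ w

  record Packings (u w c : ℕ) : Set where
    field
      left  : Packing (_≡ u) (Interval u w) ⌈ c /2⌉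
      right : Packing (_≡ w) (Interval u w) ⌈ c /2⌉
      both  : Packing (Ends u w) (Interval u w) ⌊ c /2⌋

  Packings-empty : ∀ {u w} → Packings u w 0
  Packings-empty = record { left = empty ; right = empty ; both = empty }
    where
    empty : ∀ {X A} → Packing X A 0
    empty = record { triangles = [] ; cactus = [] ; isTriangles = [] ; within = λ () ; large = z≤n }

  Packings-skip : ∀ {u w c} → Packings (suc u) w c → Packings u w c
  Packings-skip {u} P = record
    { left  = Packing-weaken (λ { (1+u≤z , _) refl → contradiction 1+u≤z (<-irrefl refl) }) widen ≤-refl left
    ; right = Packing-weaken (λ _ z≡w → z≡w) widen ≤-refl right
    ; both  = Packing-weaken (λ { (1+u≤z , _) → [ (λ { refl → contradiction 1+u≤z (<-irrefl refl) }) , (λ z≡w → z≡w) ]′ })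
                widen (⌊n/2⌋≤⌈n/2⌉ _) right
    }
    where
    open Packings P
    widen : ∀ {w z} → Interval (suc u) w z → Interval u w z
    widen (1+u≤z , z≤w) = <⇒≤ 1+u≤z , z≤w

  module _ {u v w c₁ c₂} (u<v : u < v) (v<w : v < w) (P₁ : Packings u v c₁) (P₂ : Packings v w c₂) where

    private
      module P₁ = Packings P₁
      module P₂ = Packings P₂

      meet : ∀ {z} → Interval u v z → Interval v w z → z ≡ v
      meet (_ , z≤v) (v≤z , _) = ≤-antisym z≤v v≤z

      ≢u : ∀ {z} → Interval v w z → z ≢ u
      ≢u (v≤z , _) refl = <⇒≱ u<v v≤z

      ≢w : ∀ {z} → Interval u v z → z ≢ w
      ≢w (_ , z≤v) refl = <⇒≱ v<w z≤v

      whole : ∀ {z} → Interval u v z ⊎ Interval v w z → Interval u w z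
      whole (inj₁ (u≤z , z≤v)) = u≤z , ≤-trans z≤v (<⇒≤ v<w)
      whole (inj₂ (v≤z , z≤w)) = ≤-trans (<⇒≤ u<v) v≤z , z≤w

    glue-left : Packing (_≡ u) (Interval u w) (⌈ c₁ /2⌉ + ⌈ c₂ /2⌉)
    glue-left = Packing-weaken (λ _ z≡u → z≡u) whole ≤-refl (Packing-glue P₁.left P₂.left (λ _ z≡u → z≡u) at-v)
      where
      at-v : ∀ {z} → Interval v w z → z ≡ u ⊎ Interval u v z → z ≡ v
      at-v z∈vw = [ (λ z≡u → contradiction z≡u (≢u z∈vw)) , (λ z∈uv → meet z∈uv z∈vw) ]′

    glue-right : Packing (_≡ w) (Interval u w) (⌈ c₂ /2⌉ + ⌈ c₁ /2⌉)
    glue-right = Packing-weaken (λ _ z≡w → z≡w) (whole ∘ swap) ≤-refl (Packing-glue P₂.right P₁.right (λ _ z≡w → z≡w) at-v)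
      where
      at-v : ∀ {z} → Interval u v z → z ≡ w ⊎ Interval v w z → z ≡ v
      at-v z∈uv = [ (λ z≡w → contradiction z≡w (≢w z∈uv)) , meet z∈uv ]′

    glue-both-left : Packing (Ends u w) (Interval u w) (⌈ c₁ /2⌉ + ⌊ c₂ /2⌋)
    glue-both-left = Packing-weaken (λ _ z∈uw → z∈uw) whole ≤-refl (Packing-glue P₁.left P₂.both at-u at-vw)
      where
      at-u : ∀ {z} → Interval u v z → Ends u w z → z ≡ u
      at-u z∈uv = [ (λ z≡u → z≡u) , (λ z≡w → contradiction z≡w (≢w z∈uv)) ]′
      at-vw : ∀ {z} → Interval v w z → Ends u w z ⊎ Interval u v z → Ends v w z
      at-vw z∈vw (inj₁ (inj₁ z≡u)) = contradiction z≡u (≢u z∈vw)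
      at-vw z∈vw (inj₁ (inj₂ z≡w)) = inj₂ z≡w
      at-vw z∈vw (inj₂ z∈uv)       = inj₁ (meet z∈uv z∈vw)

    glue-both-right : Packing (Ends u w) (Interval u w) (⌈ c₂ /2⌉ + ⌊ c₁ /2⌋)
    glue-both-right = Packing-weaken (λ _ z∈uw → z∈uw) (whole ∘ swap) ≤-refl (Packing-glue P₂.right P₁.both at-w at-uv)
      where
      at-w : ∀ {z} → Interval v w z → Ends u w z → z ≡ w
      at-w z∈vw = [ (λ z≡u → contradiction z≡u (≢u z∈vw)) , (λ z≡w → z≡w) ]′
      at-uv : ∀ {z} → Interval u v z → Ends u w z ⊎ Interval v w z → Ends u v z
      at-uv z∈uv (inj₁ (inj₁ z≡u)) = inj₁ z≡u
      at-uv z∈uv (inj₁ (inj₂ z≡w)) = contradiction z≡w (≢w z∈uv)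
      at-uv z∈uv (inj₂ z∈vw)       = inj₂ (meet z∈uv z∈vw)

    glue-fan : Packing (_∈ᵥ (u , v , w)) (Interval u w) (⌊ c₁ /2⌋ + ⌊ c₂ /2⌋)
    glue-fan = Packing-weaken (λ _ z∈t → z∈t) whole ≤-refl (Packing-glue P₁.both P₂.both at-uv at-vw)
      where
      at-uv : ∀ {z} → Interval u v z → z ∈ᵥ (u , v , w) → Ends u v z
      at-uv z∈uv (inj₁ z≡u)        = inj₁ z≡u
      at-uv z∈uv (inj₂ (inj₁ z≡v)) = inj₂ z≡v
      at-uv z∈uv (inj₂ (inj₂ z≡w)) = contradiction z≡w (≢w z∈uv)
      at-vw : ∀ {z} → Interval v w z → z ∈ᵥ (u , v , w) ⊎ Interval u v z → Ends v w z
      at-vw z∈vw (inj₁ (inj₁ z≡u))        = contradiction z≡u (≢u z∈vw)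
      at-vw z∈vw (inj₁ (inj₂ (inj₁ z≡v))) = inj₁ z≡v
      at-vw z∈vw (inj₁ (inj₂ (inj₂ z≡w))) = inj₂ z≡w
      at-vw z∈vw (inj₂ z∈uv)              = inj₁ (meet z∈uv z∈vw)

    Packings-split : Packings u w (c₁ + c₂)
    Packings-split = record
      { left  = Packing-shrink (⌈m+n/2⌉≤⌈m/2⌉+⌈n/2⌉ c₁ c₂) glue-left
      ; right = Packing-shrink (≤-trans (⌈m+n/2⌉≤⌈m/2⌉+⌈n/2⌉ c₁ c₂) (≤-reflexive (+-comm ⌈ c₁ /2⌉ ⌈ c₂ /2⌉)))
                  glue-right
      ; both  = Packing-shrink (⌊m+n/2⌋≤⌈m/2⌉+⌊n/2⌋ c₁ c₂) glue-both-left
      }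

    Packings-fan : E u v → E v w → E u w → Packings u w (suc (c₁ + c₂))
    Packings-fan uv vw uw = record
      { left  = [ (λ ≤glue → Packing-shrink ≤glue glue-left)
                , (λ ≤fan → Packing-shrink ≤fan
                     (fan (corners₂₃ (>⇒≢ u<v) (>⇒≢ (<-trans u<v v<w))) (λ { refl → inj₁ refl })))
                ]′ (⌈1+m+n/2⌉≤⌈m/2⌉+⌈n/2⌉⊎1+⌊m/2⌋+⌊n/2⌋ c₁ c₂)
      ; right = [ (λ ≤glue → Packing-shrink (≤-trans ≤glue (≤-reflexive (+-comm ⌈ c₁ /2⌉ ⌈ c₂ /2⌉))) glue-right)
                , (λ ≤fan → Packing-shrink ≤fan
                     (fan (corners₁₂ (<⇒≢ (<-trans u<v v<w)) (<⇒≢ v<w)) (λ { refl → inj₂ (inj₂ refl) })))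
                ]′ (⌈1+m+n/2⌉≤⌈m/2⌉+⌈n/2⌉⊎1+⌊m/2⌋+⌊n/2⌋ c₁ c₂)
      ; both  = [ (λ ≤left → Packing-shrink ≤left glue-both-left)
                , (λ ≤right → Packing-shrink (≤-trans ≤right (≤-reflexive (+-comm ⌊ c₁ /2⌋ ⌈ c₂ /2⌉))) glue-both-right)
                ]′ (⌊1+m+n/2⌋≤⌈m/2⌉+⌊n/2⌋⊎⌊m/2⌋+⌈n/2⌉ c₁ c₂)
      }
      where
      fan : ∀ {X} → TwoCorners (λ z → ¬ X z) (u , v , w) → (∀ {z} → X z → z ∈ᵥ (u , v , w)) →
            Packing X (Interval u w) (suc (⌊ c₁ /2⌋ + ⌊ c₂ /2⌋))
      fan = Packing-under glue-fan (u<v , v<w , uv , vw , uw) corner-in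
        where
        corner-in : ∀ {z} → z ∈ᵥ (u , v , w) → Interval u w z
        corner-in (inj₁ refl)        = ≤-refl , <⇒≤ (<-trans u<v v<w)
        corner-in (inj₂ (inj₁ refl)) = <⇒≤ u<v , <⇒≤ v<w
        corner-in (inj₂ (inj₂ refl)) = <⇒≤ (<-trans u<v v<w) , ≤-refl

  packings : ∀ f u w → w ≤ u + f → Packings u w (#triangles u w)
  packings f u w w≤u+f with w ≤? u
  ... | yes w≤u = subst (Packings u w) (sym (#triangles-empty w≤u)) Packings-empty
  packings zero u w w≤u+0 | no w≰u = contradiction (subst (w ≤_) (+-identityʳ u) w≤u+0) w≰u
  packings (suc f) u w w≤u+1+f | no _ with largestNeighbour u w
  ... | inj₁ none =
    subst (Packings u w) (sym (#triangles-skip none)) (Packings-skip (packings f (suc u) w (subst (w ≤_) (+-suc u f) w≤u+1+f)))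
  ... | inj₂ (v , u<v , v<w , uv , none) = combine (E? u w ×-dec E? v w) (packings f u v v≤u+f) (packings f v w w≤v+f)
    where
    w≤1+u+f = subst (w ≤_) (+-suc u f) w≤u+1+f
    v≤u+f   = ≤-pred (≤-trans v<w w≤1+u+f)
    w≤v+f   = ≤-trans w≤1+u+f (+-monoˡ-≤ f u<v)

    combine : Dec (E u w × E v w) → Packings u v (#triangles u v) → Packings v w (#triangles v w) → Packings u w (#triangles u w)
    combine (yes (uw , vw)) P₁ P₂ =
      subst (Packings u w) (sym (#triangles-fan u<v v<w uv none uw vw)) (Packings-fan u<v v<w P₁ P₂ uv vw uw)
    combine (no ¬fan)       P₁ P₂ =
      subst (Packings u w) (sym (#triangles-split u<v v<w uv none ¬fan)) (Packings-split u<v v<w P₁ P₂)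

  #triangles-all : #triangles 0 (n ∸ 1) ≡ count (isTriangle? E? ∘ toℕ³) (triples n)
  #triangles-all =
    count-≐ (triangleIn? 0 (n ∸ 1) ∘ toℕ³) (isTriangle? E? ∘ toℕ³) (proj₁ , λ {x} tri → tri , within-all x) (triples n)
    where
    within-all : ∀ (x : Fin³ n) → Within 0 (n ∸ 1) (toℕ³ x)
    within-all (_ , _ , c) = z≤n , ∸-monoˡ-≤ 1 (toℕ<n c)

  half-cactus : ∃[ L ] Cactus (_≡ 0) L × All (IsTriangle E) L × length L ≡ ⌈ count (isTriangle? E? ∘ toℕ³) (triples n) /2⌉
  half-cactus = drop k triangles , Cactus-drop k cactus , All.drop⁺ k isTriangles ,
    trans (length-drop k triangles) (trans (m∸[m∸n]≡n large) (cong ⌈_/2⌉ #triangles-all))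
    where
    open Packing (Packings.left (packings n 0 (n ∸ 1) (m∸n≤m n 1)))
    k = length triangles ∸ ⌈ #triangles 0 (n ∸ 1) /2⌉

  IsTriangle⇒Below : ∀ {t} → IsTriangle E t → Below n t
  IsTriangle⇒Below tri z∈t = E-bounded (proj₂ (triangle-corner-edge E-sym tri z∈t))

module _ {n : ℕ} (H : Adj n) where

  extend : ℕ → ℕ → Bool
  extend i j with i <? n | j <? n
  ... | yes i<n | yes j<n = H (fromℕ< i<n) (fromℕ< j<n)
  ... | _       | _       = false

  extend-toℕ : ∀ x y → extend (toℕ x) (toℕ y) ≡ H x y
  extend-toℕ x y with toℕ x <? n | toℕ y <? n
  ... | yes x<n | yes y<n = cong₂ H (fromℕ<-toℕ x x<n) (fromℕ<-toℕ y y<n)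
  ... | no x≮n  | _       = contradiction (toℕ<n x) x≮n
  ... | yes _   | no y≮n  = contradiction (toℕ<n y) y≮n

  extend-view : ∀ {i j} → T (extend i j) → ∃[ x ] ∃[ y ] toℕ x ≡ i × toℕ y ≡ j × T (H x y)
  extend-view {i} {j} e with i <? n | j <? n
  ... | yes i<n | yes j<n = fromℕ< i<n , fromℕ< j<n , toℕ-fromℕ< i<n , toℕ-fromℕ< j<n , e

module Host {n : ℕ} {H : Adj n} (outerplane : IsOuterplane H) where
  open IsOuterplane outerplane
  open IsSimpleGraph simple

  HostEdge : Rel ℕ 0ℓ
  HostEdge i j = T (extend H i j)

  T-H⇔HostEdge : ∀ x y → T (H x y) ⇔ HostEdge (toℕ x) (toℕ y)
  T-H⇔HostEdge x y = subst (λ b → T (H x y) ⇔ T b) (sym (extend-toℕ H x y)) (mk⇔ (λ h → h) (λ h → h))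

  HostEdge⇒H : ∀ {x y} → HostEdge (toℕ x) (toℕ y) → H x y ≡ true
  HostEdge⇒H {x} {y} = Equivalence.to T-≡ ∘ Equivalence.from (T-H⇔HostEdge x y)

  HostEdge-sym : Symmetric HostEdge
  HostEdge-sym e with extend-view H e
  ... | x , y , refl , refl , xy = Equivalence.to (T-H⇔HostEdge y x) (subst T (symm x y) xy)

  HostEdge-bounded : ∀ {i j} → HostEdge i j → i < n
  HostEdge-bounded e with extend-view H e
  ... | x , _ , refl , _ , _ = toℕ<n x

  HostEdge-noncrossing : ∀ {a b c d} → a < b → b < c → c < d → HostEdge a c → HostEdge b d → ⊥
  HostEdge-noncrossing a<b b<c c<d ac bd with extend-view H ac | extend-view H bd
  ... | x , z , refl , refl , xz | y , w , refl , refl , yw =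
    noncrossing x y z w a<b b<c c<d (Equivalence.to T-≡ xz) (Equivalence.to T-≡ yw)

  HostEdge? : Decidable HostEdge
  HostEdge? i j = T? (extend H i j)

  open Intervals n HostEdge? HostEdge-sym HostEdge-bounded HostEdge-noncrossing public

corollary1 : (n : ℕ) (H : Adj n) → IsOuterplane H →
    Σ (Adj n) λ S → S ⊆G H × IsTriangularCactus S × cactusTriangleCount S ≡ ⌈ innerTriangleCount H /2⌉
corollary1 n H outerplane with Host.half-cactus outerplane
... | L , cactus , triangles , L-size =
  cactusAdj L ,
  cactusAdj-⊆ L HostEdge-sym triangles HostEdge⇒H ,
  cactusAdj-isTriangularCactus L cactus sorted below ,
  (begin
    triangleCount (cactusAdj {n} L)                        ≡⟨ cactusAdj-triangleCount L cactus sorted below ⟩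
    length L                                               ≡⟨ L-size ⟩
    ⌈ count (isTriangle? HostEdge? ∘ toℕ³) (triples n) /2⌉ ≡⟨ cong ⌈_/2⌉ (triangleCount≡count H HostEdge? T-H⇔HostEdge) ⟨
    ⌈ triangleCount H /2⌉                                  ∎)
  where
  open ≡-Reasoning
  open Host outerplane
  sorted = All.map (IsTriangle⇒Sorted HostEdge) triangles
  below  = All.map IsTriangle⇒Below triangles
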